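{- Let $k$ be a field and $a,b,K\in k$, and suppose the projective closure $C\subset\mathbb{P}^2$ of the affine curve $$xy(x+y)+a(x+y)^2+(a^2+b)(x+y)+ab=Kxy$$ is smooth. Equip $C$ with the group law described in the context (identity $\mathcal{O}=[1:-1:0]$). Then the negation on $C$ is $(x,y)\mapsto(y,x)$ on affine points, and for affine points $(x_1,y_1),(x_2,y_2)$ of $C$ such that the denominators below are nonzero, $(x_1,y_1)+(x_2,y_2)=(x_3,y_3)$ with $$x_3=\frac{(ay_1-ay_2-x_1y_2+x_2y_1)(ax_1y_2-ax_2y_1-by_1+by_2)}{y_1y_2(x_1-x_2)(x_1-x_2+y_1-y_2)},$$ $$y_3=\frac{(ax_1-ax_2+x_1y_2-x_2y_1)(ax_2y_1-ax_1y_2-bx_1+bx_2)}{x_1x_2(y_1-y_2)(x_1-x_2+y_1-y_2)}.$$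
   Context: The projective closure of the curve is $xy(x+y)+a(x+y)^2z+(a^2+b)(x+y)z^2+abz^3-Kxyz=0$; $\mathcal{O}=[1:-1:0]$ is one of its points at infinity. The group law on $C$ is the chord-and-tangent law with identity $\mathcal{O}$: for $Q_1,Q_2\in C$, let $R$ be the third intersection of the line through $Q_1,Q_2$ (tangent line if $Q_1=Q_2$) with $C$, and define $Q_1+Q_2$ to be the third intersection with $C$ of the line through $\mathcal{O}$ and $R$. -}

module Defs where

open import Level using (Level; _⊔_; suc)
open import Data.Product using (Σ; _×_; _,_)
open import Relation.Nullary using (¬_)
open import Data.Empty using (⊥)
open import Algebra.Bundles using (CommutativeRing)
open import Algebra.Morphism.Structures using (module RingMorphisms)

record Field (c ℓ : Level) : Set (suc (c ⊔ ℓ)) where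
  field
    commutativeRing : CommutativeRing c ℓ
  open CommutativeRing commutativeRing public
  field
    0≉1         : ¬ (0# ≈ 1#)
    inv         : (x : Carrier) → ¬ (x ≈ 0#) → Carrier
    inv-inverse : (x : Carrier) (p : ¬ (x ≈ 0#)) → x * inv x p ≈ 1#

  div : (x y : Carrier) → ¬ (y ≈ 0#) → Carrier
  div x y p = x * inv y p

-- Vectors in k^3 (homogeneous coordinates [x:y:z] of points of P^2).
record V3 {a : Level} (A : Set a) : Set a where
  constructor ⟨_,_,_⟩
  field
    vx vy vz : A

open V3 public

module Curve {c ℓ : Level} (k : Field c ℓ) (a b K : Field.Carrier k) where
  open Field k

  two three : Carrier
  two   = 1# + 1#
  three = two + 1#

  F : V3 Carrier → Carrier
  F ⟨ x , y , z ⟩ =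
    x * y * (x + y) + a * ((x + y) * (x + y)) * z
    + (a * a + b) * (x + y) * (z * z) + a * b * (z * z * z) - K * x * y * z

  Fx Fy Fz : V3 Carrier → Carrier
  Fx ⟨ x , y , z ⟩ =
    two * x * y + y * y + two * a * (x + y) * z + (a * a + b) * (z * z) - K * y * z
  Fy ⟨ x , y , z ⟩ =
    x * x + two * x * y + two * a * (x + y) * z + (a * a + b) * (z * z) - K * x * z
  Fz ⟨ x , y , z ⟩ =
    a * ((x + y) * (x + y)) + two * (a * a + b) * (x + y) * z
    + three * a * b * (z * z) - K * x * y

  OnC : V3 Carrier → Set ℓ
  OnC P = F P ≈ 0#

  NonZeroV : V3 Carrier → Set ℓ
  NonZeroV P = ¬ ((vx P ≈ 0#) × (vy P ≈ 0#) × (vz P ≈ 0#))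

  Singular : V3 Carrier → Set ℓ
  Singular P = NonZeroV P × OnC P × (Fx P ≈ 0#) × (Fy P ≈ 0#) × (Fz P ≈ 0#)

  -- linear independence of two vectors: cross product nonzero
  Independent : V3 Carrier → V3 Carrier → Set ℓ
  Independent P Q = NonZeroV ⟨ vy P * vz Q - vz P * vy Q
                             , vz P * vx Q - vx P * vz Q
                             , vx P * vy Q - vy P * vx Q ⟩

  _≈V_ : V3 Carrier → V3 Carrier → Set ℓ
  P ≈V Q = (vx P ≈ vx Q) × (vy P ≈ vy Q) × (vz P ≈ vz Q)

  comb : Carrier → V3 Carrier → Carrier → V3 Carrier → V3 Carrier
  comb s P t Q = ⟨ s * vx P + t * vx Q , s * vy P + t * vy Q , s * vz P + t * vz Q ⟩

  grad· : V3 Carrier → V3 Carrier → Carrier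
  grad· P Q = Fx P * vx Q + Fy P * vy Q + Fz P * vz Q

  -- Restriction of C to the line spanned by P, Q:
  -- F(sP + tQ) = A s^3 + B s^2 t + C' s t^2 + D t^3 with
  -- A = F(P), B = ∇F(P)·Q, C' = ∇F(Q)·P, D = F(Q)  (F is a cubic form).
  -- Intersection (Q₁ Q₂ Q₃): Q₁, Q₂, Q₃ are the three intersection points,
  -- counted with multiplicity, of some line L with C, i.e. with
  -- Qᵢ = sᵢ P + tᵢ Q (P, Q spanning L) the binary cubic F(sP+tQ) equals
  -- c · (t₁ s - s₁ t)(t₂ s - s₂ t)(t₃ s - s₃ t) for some c ≠ 0
  -- (equality of coefficients).  Thus Q₃ is the third intersection with C
  -- of the line through Q₁, Q₂ (the tangent line at Q₁ if Q₁ = Q₂).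
  Intersection : V3 Carrier → V3 Carrier → V3 Carrier → Set (c ⊔ ℓ)
  Intersection Q₁ Q₂ Q₃ =
    Σ (V3 Carrier) λ P → Σ (V3 Carrier) λ Q → Independent P Q ×
    Σ Carrier λ s₁ → Σ Carrier λ t₁ → Σ Carrier λ s₂ → Σ Carrier λ t₂ →
    Σ Carrier λ s₃ → Σ Carrier λ t₃ →
      (Q₁ ≈V comb s₁ P t₁ Q) × (Q₂ ≈V comb s₂ P t₂ Q) × (Q₃ ≈V comb s₃ P t₃ Q) ×
      Σ Carrier λ cc → ¬ (cc ≈ 0#) ×
        (F P ≈ cc * (t₁ * t₂ * t₃)) ×
        (grad· P Q ≈ cc * (- (s₁ * t₂ * t₃ + t₁ * s₂ * t₃ + t₁ * t₂ * s₃))) ×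
        (grad· Q P ≈ cc * (s₁ * s₂ * t₃ + s₁ * t₂ * s₃ + t₁ * s₂ * s₃)) ×
        (F Q ≈ cc * (- (s₁ * s₂ * s₃)))

  O : V3 Carrier
  O = ⟨ 1# , - 1# , 0# ⟩

  -- Sum Q₁ Q₂ Q₃ : Q₁ + Q₂ = Q₃ for the chord-and-tangent law with identity O:
  -- R is the third intersection of the line Q₁Q₂ with C, and Q₃ is the
  -- third intersection of the line O R with C.
  Sum : V3 Carrier → V3 Carrier → V3 Carrier → Set (c ⊔ ℓ)
  Sum Q₁ Q₂ Q₃ = Σ (V3 Carrier) λ R → OnC R × Intersection Q₁ Q₂ R × Intersection O R Q₃

  aff : Carrier → Carrier → V3 Carrier
  aff x y = ⟨ x , y , 1# ⟩

-- Smoothness of C: no singular point over any field extension L of k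
-- (geometric smoothness; fields L at the same universe levels).
Smooth : {c ℓ : Level} (k : Field c ℓ) (a b K : Field.Carrier k) → Set (suc (c ⊔ ℓ))
Smooth {c} {ℓ} k a b K =
  (L : Field c ℓ) (φ : Field.Carrier k → Field.Carrier L) →
  RingMorphisms.IsRingHomomorphism (Field.rawRing k) (Field.rawRing L) φ →
  (P : V3 (Field.Carrier L)) → Curve.Singular L (φ a) (φ b) (φ K) P → ⊥

module Submission where

open import Level using (Level)
open import Algebra.Bundles using (CommutativeRing; AbelianGroup)
open import Algebra.Structures using (IsCommutativeRing)
open import Algebra.Morphism.Structures using (module RingMorphisms)
import Algebra.Morphism.Construct.Identity as Identity
open import Algebra.Construct.DirectProduct using (abelianGroup)
import Algebra.Consequences.Setoid as Consequences
import Algebra.Solver.Ring.AlmostCommutativeRing as ACR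
open import Data.Nat.Base as ℕ using (ℕ; zero; suc)
import Data.Nat.Properties as ℕ
open import Data.Integer.Base as ℤ using (ℤ; +_; -[1+_]; _⊖_; _◃_; sign; ∣_∣)
import Data.Integer.Properties as ℤ
open import Data.Sign.Base as Sign using (Sign)
open import Data.Maybe.Base using (Maybe; just; nothing)
open import Data.Product.Base using (Σ; _×_; _,_; proj₁; proj₂)
open import Relation.Nullary using (¬_; yes; no)
open import Relation.Nullary.Decidable using (¬¬-excluded-middle)
import Relation.Binary.PropositionalEquality as ≡
open import Defs

-- The group law is computed from two kinds of lines:
--  * a chord through points P, Q of C: F restricted to s P + t Q is
--    s t (B s + C t) with B = ∇F(P)·Q, C = ∇F(Q)·P, so its third point is
--    C P - B Q (lemma chord);
--  * lines through O = [1 : -1 : 0], i.e. x + y = const: the line through O and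
--    an affine point (x , y) of C meets C again at (y , x) (line-through-O),
--    and the tangent at O, x + y = K z, meets C only at O (O-flex).
-- Both need c₀ = F(K , 0 , 1) = (a K + b)(K + a) to be nonzero.  This is where
-- smoothness enters: if c₀ = 0, C contains the line x + y = K z and is singular
-- where that line meets the residual conic, at the roots of a quadratic, which
-- exist in k or in a quadratic extension of k (built here as a field).
-- Negation is then a chord followed by the tangent at O; addition is the chord
-- P₁ P₂, whose third point is (y₃ , x₃) by two polynomial identities, followed
-- by the line through O.

module IntegerSolver {c ℓ : Level} (R : CommutativeRing c ℓ) where
  open CommutativeRing R
  open import Algebra.Properties.Semiring.Mult.TCOptimised semiring
    using (1+×; ×-homo-+; ×1-homo-*) renaming (_×_ to _·_)
  open import Algebra.Properties.Ring ring using (-‿distribˡ-*; -1*x≈-x; -0#≈0#)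
  open import Algebra.Properties.AbelianGroup +-abelianGroup using (⁻¹-∙-comm)
  open import Algebra.Properties.Group +-group using (⁻¹-involutive)
  open import Algebra.Properties.CommutativeSemigroup *-commutativeSemigroup
    using (interchange)
  open import Relation.Binary.Reasoning.Setoid setoid

  ⟦_⟧ℤ : ℤ → Carrier
  ⟦ + n ⟧ℤ      = n · 1#
  ⟦ -[1+ n ] ⟧ℤ = - (suc n · 1#)

  ⟦_⟧sign : Sign → Carrier
  ⟦ Sign.+ ⟧sign = 1#
  ⟦ Sign.- ⟧sign = - 1#

  cancel-one : ∀ M N → (1# + M) - (1# + N) ≈ M - N
  cancel-one M N = begin
    (1# + M) + - (1# + N)      ≈⟨ +-congˡ (sym (⁻¹-∙-comm 1# N)) ⟩
    (1# + M) + (- 1# + - N)    ≈⟨ +-assoc 1# M _ ⟩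
    1# + (M + (- 1# + - N))    ≈⟨ +-congˡ (sym (+-assoc M _ _)) ⟩
    1# + ((M + - 1#) + - N)    ≈⟨ +-congˡ (+-congʳ (+-comm M _)) ⟩
    1# + ((- 1# + M) + - N)    ≈⟨ +-congˡ (+-assoc _ M _) ⟩
    1# + (- 1# + (M + - N))    ≈⟨ sym (+-assoc _ _ _) ⟩
    (1# + - 1#) + (M + - N)    ≈⟨ +-congʳ (-‿inverseʳ 1#) ⟩
    0# + (M + - N)             ≈⟨ +-identityˡ _ ⟩
    M + - N                    ∎

  ⊖-homo : ∀ m n → ⟦ m ⊖ n ⟧ℤ ≈ m · 1# - n · 1#
  ⊖-homo zero    zero    = sym (trans (+-congˡ -0#≈0#) (+-identityʳ 0#))
  ⊖-homo (suc m) zero    = sym (trans (+-congˡ -0#≈0#) (+-identityʳ _))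
  ⊖-homo zero    (suc n) = sym (+-identityˡ _)
  ⊖-homo (suc m) (suc n) = begin
    ⟦ suc m ⊖ suc n ⟧ℤ          ≈⟨ reflexive (≡.cong ⟦_⟧ℤ (ℤ.[1+m]⊖[1+n]≡m⊖n m n)) ⟩
    ⟦ m ⊖ n ⟧ℤ                  ≈⟨ ⊖-homo m n ⟩
    m · 1# - n · 1#             ≈⟨ cancel-one _ _ ⟨
    (1# + m · 1#) - (1# + n · 1#) ≈⟨ +-cong (1+× m 1#) (-‿cong (1+× n 1#)) ⟨
    suc m · 1# - suc n · 1#     ∎

  +-homo : ∀ i j → ⟦ i ℤ.+ j ⟧ℤ ≈ ⟦ i ⟧ℤ + ⟦ j ⟧ℤ
  +-homo (+ m)    (+ n)    = ×-homo-+ 1# m n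
  +-homo (+ m)    -[1+ n ] = ⊖-homo m (suc n)
  +-homo -[1+ m ] (+ n)    = trans (⊖-homo n (suc m)) (+-comm _ _)
  +-homo -[1+ m ] -[1+ n ] = begin
    - (suc (suc (m ℕ.+ n)) · 1#)  ≈⟨ -‿cong (reflexive (≡.cong (λ k → suc k · 1#) (ℕ.+-suc m n))) ⟨
    - ((suc m ℕ.+ suc n) · 1#)    ≈⟨ -‿cong (×-homo-+ 1# (suc m) (suc n)) ⟩
    - (suc m · 1# + suc n · 1#)   ≈⟨ ⁻¹-∙-comm _ _ ⟨
    - (suc m · 1#) + - (suc n · 1#) ∎

  ◃-homo : ∀ s n → ⟦ s ◃ n ⟧ℤ ≈ ⟦ s ⟧sign * (n · 1#)
  ◃-homo s        zero    = sym (zeroʳ ⟦ s ⟧sign)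
  ◃-homo Sign.+ (suc n) = sym (*-identityˡ _)
  ◃-homo Sign.- (suc n) = trans (-‿cong (sym (*-identityˡ _))) (-‿distribˡ-* 1# _)

  sign-homo : ∀ s t → ⟦ s Sign.* t ⟧sign ≈ ⟦ s ⟧sign * ⟦ t ⟧sign
  sign-homo Sign.+ Sign.+ = sym (*-identityˡ _)
  sign-homo Sign.+ Sign.- = sym (*-identityˡ _)
  sign-homo Sign.- Sign.+ = sym (*-identityʳ _)
  sign-homo Sign.- Sign.- = sym (trans (-1*x≈-x (- 1#)) (⁻¹-involutive 1#))

  sign-magnitude : ∀ i → ⟦ i ⟧ℤ ≈ ⟦ sign i ⟧sign * (∣ i ∣ · 1#)
  sign-magnitude i =
    trans (reflexive (≡.cong ⟦_⟧ℤ (≡.sym (ℤ.◃-inverse i)))) (◃-homo (sign i) ∣ i ∣)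

  *-homo : ∀ i j → ⟦ i ℤ.* j ⟧ℤ ≈ ⟦ i ⟧ℤ * ⟦ j ⟧ℤ
  *-homo i j = begin
    ⟦ i ℤ.* j ⟧ℤ
      ≈⟨ ◃-homo (sign i Sign.* sign j) (∣ i ∣ ℕ.* ∣ j ∣) ⟩
    ⟦ sign i Sign.* sign j ⟧sign * ((∣ i ∣ ℕ.* ∣ j ∣) · 1#)
      ≈⟨ *-cong (sign-homo (sign i) (sign j)) (×1-homo-* ∣ i ∣ ∣ j ∣) ⟩
    (⟦ sign i ⟧sign * ⟦ sign j ⟧sign) * ((∣ i ∣ · 1#) * (∣ j ∣ · 1#))
      ≈⟨ interchange _ _ _ _ ⟩
    (⟦ sign i ⟧sign * (∣ i ∣ · 1#)) * (⟦ sign j ⟧sign * (∣ j ∣ · 1#))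
      ≈⟨ *-cong (sign-magnitude i) (sign-magnitude j) ⟨
    ⟦ i ⟧ℤ * ⟦ j ⟧ℤ ∎

  neg-homo : ∀ i → ⟦ ℤ.- i ⟧ℤ ≈ - ⟦ i ⟧ℤ
  neg-homo (+ zero)  = sym -0#≈0#
  neg-homo (+ suc n) = refl
  neg-homo -[1+ n ]  = sym (⁻¹-involutive _)

  private
    almostCommutativeRing : ACR.AlmostCommutativeRing c ℓ
    almostCommutativeRing = ACR.fromCommutativeRing R

    ℤ-morphism : ℤ.+-*-rawRing ACR.-Raw-AlmostCommutative⟶ almostCommutativeRing
    ℤ-morphism = record
      { ⟦_⟧ = ⟦_⟧ℤ ; +-homo = +-homo ; *-homo = *-homo ; -‿homo = neg-homo
      ; 0-homo = refl ; 1-homo = refl }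

    ℤ-coefficient-test : ∀ i j → Maybe (⟦ i ⟧ℤ ≈ ⟦ j ⟧ℤ)
    ℤ-coefficient-test i j with i ℤ.≟ j
    ... | yes ≡.refl = just refl
    ... | no _       = nothing

  open import Algebra.Solver.Ring ℤ.+-*-rawRing almostCommutativeRing
    ℤ-morphism ℤ-coefficient-test public

  0ᴾ 1ᴾ 2ᴾ 3ᴾ : ∀ {n} → Polynomial n
  0ᴾ = con (+ 0)
  1ᴾ = con (+ 1)
  2ᴾ = 1ᴾ :+ 1ᴾ
  3ᴾ = 2ᴾ :+ 1ᴾ

module FieldFacts {c ℓ : Level} (k : Field c ℓ) where
  open Field k public
  open IntegerSolver commutativeRing public
  open import Algebra.Properties.Ring ring public using (-0#≈0#)
  open import Relation.Binary.Reasoning.Setoid setoid public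

  nonzero-factorˡ : ∀ {x y} → ¬ (x * y ≈ 0#) → ¬ (x ≈ 0#)
  nonzero-factorˡ {x} {y} xy≉0 x≈0 = xy≉0 (trans (*-congʳ x≈0) (zeroˡ y))

  nonzero-factorʳ : ∀ {x y} → ¬ (x * y ≈ 0#) → ¬ (y ≈ 0#)
  nonzero-factorʳ {x} {y} xy≉0 y≈0 = xy≉0 (trans (*-congˡ y≈0) (zeroʳ x))

  *-nonzero : ∀ {x y} → ¬ (x ≈ 0#) → ¬ (y ≈ 0#) → ¬ (x * y ≈ 0#)
  *-nonzero {x} {y} x≉0 y≉0 xy≈0 = y≉0 (begin
    y                   ≈⟨ solve 2 (λ y i → y := y :* 1ᴾ) refl y x⁻¹ ⟩
    y * 1#              ≈⟨ *-congˡ (inv-inverse x x≉0) ⟨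
    y * (x * x⁻¹)       ≈⟨ solve 3 (λ x y i → y :* (x :* i) := (x :* y) :* i) refl x y x⁻¹ ⟩
    (x * y) * x⁻¹       ≈⟨ *-congʳ xy≈0 ⟩
    0# * x⁻¹            ≈⟨ zeroˡ x⁻¹ ⟩
    0#                  ∎)
    where
    x⁻¹ : Carrier
    x⁻¹ = inv x x≉0

  -‿nonzero : ∀ {x} → ¬ (x ≈ 0#) → ¬ (- x ≈ 0#)
  -‿nonzero {x} x≉0 -x≈0 = x≉0 (begin
    x       ≈⟨ solve 1 (λ x → x := :- (:- x)) refl x ⟩
    - (- x) ≈⟨ -‿cong -x≈0 ⟩
    - 0#    ≈⟨ -0#≈0# ⟩
    0#      ∎)

  1≉0 : ¬ (1# ≈ 0#)
  1≉0 1≈0 = 0≉1 (sym 1≈0)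

  div-cross : ∀ u d n e (d≉0 : ¬ (d ≈ 0#)) (e≉0 : ¬ (e ≈ 0#)) →
              u * d ≈ n * e → u * inv e e≉0 ≈ n * inv d d≉0
  div-cross u d n e d≉0 e≉0 ud≈ne = begin
    u * e⁻¹                 ≈⟨ solve 2 (λ u i → u :* i := u :* i :* 1ᴾ) refl u e⁻¹ ⟩
    u * e⁻¹ * 1#            ≈⟨ *-congˡ (inv-inverse d d≉0) ⟨
    u * e⁻¹ * (d * d⁻¹)     ≈⟨ solve 4 (λ u i d j → u :* i :* (d :* j) := (u :* d) :* (i :* j))
                                 refl u e⁻¹ d d⁻¹ ⟩
    (u * d) * (e⁻¹ * d⁻¹)   ≈⟨ *-congʳ ud≈ne ⟩
    (n * e) * (e⁻¹ * d⁻¹)   ≈⟨ solve 4 (λ n e i j → (n :* e) :* (i :* j) := n :* j :* (e :* i))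
                                 refl n e e⁻¹ d⁻¹ ⟩
    n * d⁻¹ * (e * e⁻¹)     ≈⟨ *-congˡ (inv-inverse e e≉0) ⟩
    n * d⁻¹ * 1#            ≈⟨ *-identityʳ _ ⟩
    n * d⁻¹                 ∎
    where
    e⁻¹ d⁻¹ : Carrier
    e⁻¹ = inv e e≉0
    d⁻¹ = inv d d≉0

  *-div-cancel : ∀ d (d≉0 : ¬ (d ≈ 0#)) u → d * (u * inv d d≉0) ≈ u
  *-div-cancel d d≉0 u = begin
    d * (u * d⁻¹) ≈⟨ solve 3 (λ d u i → d :* (u :* i) := u :* (d :* i)) refl d u d⁻¹ ⟩
    u * (d * d⁻¹) ≈⟨ *-congˡ (inv-inverse d d≉0) ⟩
    u * 1#        ≈⟨ *-identityʳ u ⟩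
    u             ∎
    where
    d⁻¹ : Carrier
    d⁻¹ = inv d d≉0

  drop-vanishing : ∀ {X Y p q f g} → X ≈ Y + p * f + q * g → f ≈ 0# → g ≈ 0# → X ≈ Y
  drop-vanishing {X} {Y} {p} {q} {f} {g} X≈ f≈0 g≈0 = begin
    X                   ≈⟨ X≈ ⟩
    Y + p * f + q * g   ≈⟨ +-cong (+-congˡ (*-congˡ f≈0)) (*-congˡ g≈0) ⟩
    Y + p * 0# + q * 0# ≈⟨ solve 3 (λ Y p q → Y :+ p :* 0ᴾ :+ q :* 0ᴾ := Y) refl Y p q ⟩
    Y                   ∎

IsQuadraticRoot : ∀ {c ℓ} (k : Field c ℓ) (p q t : Field.Carrier k) → Set ℓ
IsQuadraticRoot k p q t = t * t - p * t - q ≈ 0#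
  where open Field k

record RootExtension {c ℓ : Level} (k : Field c ℓ) (p q : Field.Carrier k)
         : Set (Level.suc (c Level.⊔ ℓ)) where
  field
    L         : Field c ℓ
    embed     : Field.Carrier k → Field.Carrier L
    embed-hom : RingMorphisms.IsRingHomomorphism (Field.rawRing k) (Field.rawRing L) embed
    root      : Field.Carrier L
    root-eq   : IsQuadraticRoot L (embed p) (embed q) root

-- If t² - p t - q has no root in k, then k[θ]/(θ² - p θ - q) is a field:
-- its elements are pairs (u , v) standing for u + v θ, and the inverse of a
-- nonzero element is its conjugate (u + p v) - v θ divided by its norm.
module QuadraticExtension {c ℓ : Level} (k : Field c ℓ)
  (p q : Field.Carrier k) (no-root : ¬ Σ (Field.Carrier k) (IsQuadraticRoot k p q)) where
  open FieldFacts k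

  private
    module Additive = AbelianGroup (abelianGroup +-abelianGroup +-abelianGroup)

  Elt : Set c
  Elt = Carrier × Carrier

  _≈ᴱ_ : Elt → Elt → Set ℓ
  _≈ᴱ_ = Additive._≈_

  _+ᴱ_ : Elt → Elt → Elt
  _+ᴱ_ = Additive._∙_

  -ᴱ_ : Elt → Elt
  -ᴱ_ = Additive._⁻¹

  0ᴱ 1ᴱ θ : Elt
  0ᴱ = Additive.ε
  1ᴱ = (1# , 0#)
  θ  = (0# , 1#)

  _*ᴱ_ : Elt → Elt → Elt
  (u , v) *ᴱ (u′ , v′) = (u * u′ + q * (v * v′) , u * v′ + v * u′ + p * (v * v′))

  mulᴾ : ∀ {n} (p q : Polynomial n) → Polynomial n × Polynomial n →
         Polynomial n × Polynomial n → Polynomial n × Polynomial n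
  mulᴾ p q (u , v) (u′ , v′) = (u :* u′ :+ q :* (v :* v′) , u :* v′ :+ v :* u′ :+ p :* (v :* v′))

  *ᴱ-cong : ∀ {x x′ y y′} → x ≈ᴱ x′ → y ≈ᴱ y′ → (x *ᴱ y) ≈ᴱ (x′ *ᴱ y′)
  *ᴱ-cong (u≈ , v≈) (u′≈ , v′≈) =
    +-cong (*-cong u≈ u′≈) (*-congˡ (*-cong v≈ v′≈)) ,
    +-cong (+-cong (*-cong u≈ v′≈) (*-cong v≈ u′≈)) (*-congˡ (*-cong v≈ v′≈))

  *ᴱ-assoc : ∀ x y z → ((x *ᴱ y) *ᴱ z) ≈ᴱ (x *ᴱ (y *ᴱ z))
  *ᴱ-assoc (u , v) (u′ , v′) (u″ , v″) =
    solve 8 (λ p q u v u′ v′ u″ v″ →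
      proj₁ (mulᴾ p q (mulᴾ p q (u , v) (u′ , v′)) (u″ , v″))
        := proj₁ (mulᴾ p q (u , v) (mulᴾ p q (u′ , v′) (u″ , v″)))) refl p q u v u′ v′ u″ v″ ,
    solve 8 (λ p q u v u′ v′ u″ v″ →
      proj₂ (mulᴾ p q (mulᴾ p q (u , v) (u′ , v′)) (u″ , v″))
        := proj₂ (mulᴾ p q (u , v) (mulᴾ p q (u′ , v′) (u″ , v″)))) refl p q u v u′ v′ u″ v″

  *ᴱ-comm : ∀ x y → (x *ᴱ y) ≈ᴱ (y *ᴱ x)
  *ᴱ-comm (u , v) (u′ , v′) =
    solve 6 (λ p q u v u′ v′ → proj₁ (mulᴾ p q (u , v) (u′ , v′)) := proj₁ (mulᴾ p q (u′ , v′) (u , v)))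
      refl p q u v u′ v′ ,
    solve 6 (λ p q u v u′ v′ → proj₂ (mulᴾ p q (u , v) (u′ , v′)) := proj₂ (mulᴾ p q (u′ , v′) (u , v)))
      refl p q u v u′ v′

  *ᴱ-identityˡ : ∀ x → (1ᴱ *ᴱ x) ≈ᴱ x
  *ᴱ-identityˡ (u , v) =
    solve 4 (λ p q u v → proj₁ (mulᴾ p q (1ᴾ , 0ᴾ) (u , v)) := u) refl p q u v ,
    solve 4 (λ p q u v → proj₂ (mulᴾ p q (1ᴾ , 0ᴾ) (u , v)) := v) refl p q u v

  *ᴱ-distribˡ : ∀ x y z → (x *ᴱ (y +ᴱ z)) ≈ᴱ ((x *ᴱ y) +ᴱ (x *ᴱ z))
  *ᴱ-distribˡ (u , v) (u′ , v′) (u″ , v″) =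
    solve 8 (λ p q u v u′ v′ u″ v″ →
      proj₁ (mulᴾ p q (u , v) (u′ :+ u″ , v′ :+ v″))
        := proj₁ (mulᴾ p q (u , v) (u′ , v′)) :+ proj₁ (mulᴾ p q (u , v) (u″ , v″)))
      refl p q u v u′ v′ u″ v″ ,
    solve 8 (λ p q u v u′ v′ u″ v″ →
      proj₂ (mulᴾ p q (u , v) (u′ :+ u″ , v′ :+ v″))
        := proj₂ (mulᴾ p q (u , v) (u′ , v′)) :+ proj₂ (mulᴾ p q (u , v) (u″ , v″)))
      refl p q u v u′ v′ u″ v″

  *ᴱ-isCommutativeRing : IsCommutativeRing _≈ᴱ_ _+ᴱ_ _*ᴱ_ -ᴱ_ 0ᴱ 1ᴱ
  *ᴱ-isCommutativeRing = record
    { isRing = record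
      { +-isAbelianGroup = Additive.isAbelianGroup
      ; *-cong           = *ᴱ-cong
      ; *-assoc          = *ᴱ-assoc
      ; *-identity       = comm∧idˡ⇒id *ᴱ-comm *ᴱ-identityˡ
      ; distrib          = comm∧distrˡ⇒distr Additive.∙-cong *ᴱ-comm *ᴱ-distribˡ
      }
    ; *-comm = *ᴱ-comm
    }
    where open Consequences Additive.setoid using (comm∧idˡ⇒id; comm∧distrˡ⇒distr)

  -- the norm of u + v θ, i.e. its product with the conjugate (u + p v) - v θ
  norm : Elt → Carrier
  norm (u , v) = u * u + p * u * v - q * v * v

  norm-root : ∀ u v (v≉0 : ¬ (v ≈ 0#)) → norm (u , v) ≈ 0# →
              IsQuadraticRoot k p q (- u * inv v v≉0)
  norm-root u v v≉0 N≈0 = begin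
    (- u * v⁻¹) * (- u * v⁻¹) - p * (- u * v⁻¹) - q
      ≈⟨ solve 5 (λ u v p q i →
           (:- u :* i) :* (:- u :* i) :- p :* (:- u :* i) :- q
             := (u :* u :+ p :* u :* v :- q :* v :* v) :* i :* i
                :+ (1ᴾ :- v :* i) :* (p :* u :* i :- q :* (1ᴾ :+ v :* i))) refl u v p q v⁻¹ ⟩
    norm (u , v) * v⁻¹ * v⁻¹ + (1# - v * v⁻¹) * (p * u * v⁻¹ - q * (1# + v * v⁻¹))
      ≈⟨ +-cong (*-congʳ (*-congʳ N≈0)) (*-congʳ (+-congˡ (-‿cong (inv-inverse v v≉0)))) ⟩
    0# * v⁻¹ * v⁻¹ + (1# - 1#) * (p * u * v⁻¹ - q * (1# + v * v⁻¹))
      ≈⟨ solve 2 (λ i w → 0ᴾ :* i :* i :+ (1ᴾ :- 1ᴾ) :* w := 0ᴾ) refl v⁻¹ _ ⟩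
    0# ∎
    where
    v⁻¹ : Carrier
    v⁻¹ = inv v v≉0

  norm-of-embedded : ∀ u v → v ≈ 0# → norm (u , v) ≈ u * u
  norm-of-embedded u v v≈0 = begin
    norm (u , v)                       ≈⟨ solve 4 (λ u v p q →
                                            u :* u :+ p :* u :* v :- q :* v :* v
                                              := u :* u :+ (p :* u :- q :* v) :* v) refl u v p q ⟩
    u * u + (p * u - q * v) * v        ≈⟨ +-congˡ (*-congˡ v≈0) ⟩
    u * u + (p * u - q * v) * 0#       ≈⟨ solve 2 (λ u w → u :* u :+ w :* 0ᴾ := u :* u) refl u _ ⟩
    u * u                              ∎

  -- since t² - p t - q has no root, only 0 has norm 0
  norm-nonzero : ∀ x → ¬ (x ≈ᴱ 0ᴱ) → ¬ (norm x ≈ 0#)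
  norm-nonzero (u , v) x≉0 N≈0 = ¬¬-excluded-middle λ
    { (yes v≈0) → let u≉0 : ¬ (u ≈ 0#)
                      u≉0 u≈0 = x≉0 (u≈0 , v≈0)
                  in *-nonzero u≉0 u≉0 (trans (sym (norm-of-embedded u v v≈0)) N≈0)
    ; (no v≉0) → no-root (- u * inv v v≉0 , norm-root u v v≉0 N≈0) }

  invᴱ : ∀ x → ¬ (x ≈ᴱ 0ᴱ) → Elt
  invᴱ (u , v) x≉0 = ((u + p * v) * N⁻¹ , (- v) * N⁻¹)
    where
    N⁻¹ : Carrier
    N⁻¹ = inv (norm (u , v)) (norm-nonzero (u , v) x≉0)

  invᴱ-inverse : ∀ x (x≉0 : ¬ (x ≈ᴱ 0ᴱ)) → (x *ᴱ invᴱ x x≉0) ≈ᴱ 1ᴱ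
  invᴱ-inverse (u , v) x≉0 =
    trans (solve 5 (λ p q u v i → proj₁ (mulᴾ p q (u , v) ((u :+ p :* v) :* i , (:- v) :* i))
                                    := (u :* u :+ p :* u :* v :- q :* v :* v) :* i) refl p q u v N⁻¹)
          (inv-inverse _ N≉0) ,
    solve 5 (λ p q u v i → proj₂ (mulᴾ p q (u , v) ((u :+ p :* v) :* i , (:- v) :* i)) := 0ᴾ)
      refl p q u v N⁻¹
    where
    N≉0 : ¬ (norm (u , v) ≈ 0#)
    N≉0 = norm-nonzero (u , v) x≉0
    N⁻¹ : Carrier
    N⁻¹ = inv (norm (u , v)) N≉0

  L : Field c ℓ
  L = record
    { commutativeRing = record { isCommutativeRing = *ᴱ-isCommutativeRing }
    ; 0≉1             = λ (0≈1 , _) → 0≉1 0≈1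
    ; inv             = invᴱ
    ; inv-inverse     = invᴱ-inverse
    }

  embed : Carrier → Elt
  embed u = (u , 0#)

  embed-hom : RingMorphisms.IsRingHomomorphism (Field.rawRing k) (Field.rawRing L) embed
  embed-hom = record
    { isSemiringHomomorphism = record
      { isNearSemiringHomomorphism = record
        { +-isMonoidHomomorphism = record
          { isMagmaHomomorphism = record
            { isRelHomomorphism = record { cong = λ u≈u′ → u≈u′ , refl }
            ; homo = λ _ _ → refl , sym (+-identityʳ 0#) }
          ; ε-homo = refl , refl }
        ; *-homo = λ u u′ →
            solve 4 (λ p q u u′ → u :* u′ := proj₁ (mulᴾ p q (u , 0ᴾ) (u′ , 0ᴾ))) refl p q u u′ ,
            solve 4 (λ p q u u′ → 0ᴾ := proj₂ (mulᴾ p q (u , 0ᴾ) (u′ , 0ᴾ))) refl p q u u′ }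
      ; 1#-homo = refl , refl }
    ; -‿homo = λ _ → refl , sym -0#≈0# }

  θ-root : IsQuadraticRoot L (embed p) (embed q) θ
  θ-root =
    solve 2 (λ p q → proj₁ (mulᴾ p q (0ᴾ , 1ᴾ) (0ᴾ , 1ᴾ)) :- proj₁ (mulᴾ p q (p , 0ᴾ) (0ᴾ , 1ᴾ)) :- q
                     := 0ᴾ) refl p q ,
    solve 2 (λ p q → proj₂ (mulᴾ p q (0ᴾ , 1ᴾ) (0ᴾ , 1ᴾ)) :- proj₂ (mulᴾ p q (p , 0ᴾ) (0ᴾ , 1ᴾ)) :- 0ᴾ
                     := 0ᴾ) refl p q

  rootExtension : RootExtension k p q
  rootExtension = record
    { L = L ; embed = embed ; embed-hom = embed-hom ; root = θ ; root-eq = θ-root }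

-- Every monic quadratic over k acquires a root in some field extension:
-- k itself if it already has a root, the quadratic extension otherwise.
-- (Constructively this holds up to double negation.)
root-in-extension : ∀ {c ℓ} (k : Field c ℓ) (p q : Field.Carrier k) → ¬ ¬ RootExtension k p q
root-in-extension k p q no-extension =
  ¬¬-excluded-middle {A = Σ (Field.Carrier k) (IsQuadraticRoot k p q)} λ
  { (yes (t , t-root)) → no-extension record
      { L = k ; embed = λ x → x
      ; embed-hom = Identity.isRingHomomorphism (Field.rawRing k) (Field.refl k)
      ; root = t ; root-eq = t-root }
  ; (no no-root) → no-extension (QuadraticExtension.rootExtension k p q no-root) }

module CurveFacts {c ℓ : Level} (k : Field c ℓ) (a b K : Field.Carrier k) where
  open FieldFacts k
  open Curve k a b K

  module _ {n : ℕ} (a b K : Polynomial n) where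
    Fᴾ Fxᴾ Fyᴾ Fzᴾ : V3 (Polynomial n) → Polynomial n
    Fᴾ ⟨ x , y , z ⟩ =
      x :* y :* (x :+ y) :+ a :* ((x :+ y) :* (x :+ y)) :* z
      :+ (a :* a :+ b) :* (x :+ y) :* (z :* z) :+ a :* b :* (z :* z :* z) :- K :* x :* y :* z
    Fxᴾ ⟨ x , y , z ⟩ =
      2ᴾ :* x :* y :+ y :* y :+ 2ᴾ :* a :* (x :+ y) :* z :+ (a :* a :+ b) :* (z :* z) :- K :* y :* z
    Fyᴾ ⟨ x , y , z ⟩ =
      x :* x :+ 2ᴾ :* x :* y :+ 2ᴾ :* a :* (x :+ y) :* z :+ (a :* a :+ b) :* (z :* z) :- K :* x :* z
    Fzᴾ ⟨ x , y , z ⟩ =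
      a :* ((x :+ y) :* (x :+ y)) :+ 2ᴾ :* (a :* a :+ b) :* (x :+ y) :* z
      :+ 3ᴾ :* a :* b :* (z :* z) :- K :* x :* y

    gradᴾ : V3 (Polynomial n) → V3 (Polynomial n) → Polynomial n
    gradᴾ P Q = Fxᴾ P :* vx Q :+ Fyᴾ P :* vy Q :+ Fzᴾ P :* vz Q

  Oᴾ : ∀ {n} → V3 (Polynomial n)
  Oᴾ = ⟨ 1ᴾ , :- 1ᴾ , 0ᴾ ⟩

  affᴾ : ∀ {n} → Polynomial n → Polynomial n → V3 (Polynomial n)
  affᴾ x y = ⟨ x , y , 1ᴾ ⟩

  combᴾ : ∀ {n} → Polynomial n → V3 (Polynomial n) → Polynomial n → V3 (Polynomial n) →
          V3 (Polynomial n)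
  combᴾ s P t Q = ⟨ s :* vx P :+ t :* vx Q , s :* vy P :+ t :* vy Q , s :* vz P :+ t :* vz Q ⟩

  F-cong : ∀ {P Q} → P ≈V Q → F P ≈ F Q
  F-cong (x≈ , y≈ , z≈) =
    +-cong (+-cong (+-cong (+-cong (*-cong (*-cong x≈ y≈) (+-cong x≈ y≈))
                                   (*-cong (*-congˡ (*-cong (+-cong x≈ y≈) (+-cong x≈ y≈))) z≈))
                           (*-cong (*-congˡ (+-cong x≈ y≈)) (*-cong z≈ z≈)))
                   (*-congˡ (*-cong (*-cong z≈ z≈) z≈)))
           (-‿cong (*-cong (*-cong (*-congˡ x≈) y≈) z≈))

  -- F is a cubic form, so on the line through P and Q it is the binary cubic
  -- with coefficients F P, ∇F(P)·Q, ∇F(Q)·P, F Q.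
  F-on-line : ∀ P Q s t →
    F (comb s P t Q) ≈ F P * (s * s * s) + grad· P Q * (s * s * t)
                       + grad· Q P * (s * t * t) + F Q * (t * t * t)
  F-on-line ⟨ x , y , z ⟩ ⟨ x′ , y′ , z′ ⟩ s t =
    solve 11 (λ a b K x y z x′ y′ z′ s t →
      let P = ⟨ x , y , z ⟩ ; Q = ⟨ x′ , y′ , z′ ⟩ in
      Fᴾ a b K (combᴾ s P t Q)
        := Fᴾ a b K P :* (s :* s :* s) :+ gradᴾ a b K P Q :* (s :* s :* t)
           :+ gradᴾ a b K Q P :* (s :* t :* t) :+ Fᴾ a b K Q :* (t :* t :* t))
      refl a b K x y z x′ y′ z′ s t

  -- Every point of an intersection lies on C: substituting the factored
  -- coefficients, F(s P + t Q) = c ∏ᵢ (tᵢ s - sᵢ t), which vanishes at (s₃ , t₃).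
  intersection-on-C : ∀ {Q₁ Q₂ Q₃} → Intersection Q₁ Q₂ Q₃ → OnC Q₃
  intersection-on-C {Q₃ = Q₃} (P , Q , _ , s₁ , t₁ , s₂ , t₂ , s₃ , t₃ , _ , _ , Q₃≈ , c , _ , A≈ , B≈ , C≈ , D≈) =
    begin
      F Q₃               ≈⟨ F-cong Q₃≈ ⟩
      F (comb s₃ P t₃ Q) ≈⟨ F-on-line P Q s₃ t₃ ⟩
      _                  ≈⟨ +-cong (+-cong (+-cong (*-congʳ A≈) (*-congʳ B≈)) (*-congʳ C≈)) (*-congʳ D≈) ⟩
      _                  ≈⟨ solve 7 (λ s₁ t₁ s₂ t₂ s₃ t₃ c →
                               c :* (t₁ :* t₂ :* t₃) :* (s₃ :* s₃ :* s₃)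
                               :+ c :* (:- (s₁ :* t₂ :* t₃ :+ t₁ :* s₂ :* t₃ :+ t₁ :* t₂ :* s₃)) :* (s₃ :* s₃ :* t₃)
                               :+ c :* (s₁ :* s₂ :* t₃ :+ s₁ :* t₂ :* s₃ :+ t₁ :* s₂ :* s₃) :* (s₃ :* t₃ :* t₃)
                               :+ c :* (:- (s₁ :* s₂ :* s₃)) :* (t₃ :* t₃ :* t₃) := 0ᴾ)
                            refl s₁ t₁ s₂ t₂ s₃ t₃ c ⟩
      0#                 ∎

  Intersection-rotate : ∀ {Q₁ Q₂ Q₃} → Intersection Q₁ Q₂ Q₃ → Intersection Q₂ Q₃ Q₁
  Intersection-rotate (P , Q , ind , s₁ , t₁ , s₂ , t₂ , s₃ , t₃ , Q₁≈ , Q₂≈ , Q₃≈ , c , c≉0 , A≈ , B≈ , C≈ , D≈) =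
    P , Q , ind , s₂ , t₂ , s₃ , t₃ , s₁ , t₁ , Q₂≈ , Q₃≈ , Q₁≈ , c , c≉0 ,
    trans A≈ (*-congˡ t-product) , trans B≈ (*-congˡ (-‿cong st-sum)) ,
    trans C≈ (*-congˡ ss-sum) , trans D≈ (*-congˡ (-‿cong s-product))
    where
    -- the coefficients are symmetric functions of the three roots
    t-product : t₁ * t₂ * t₃ ≈ t₂ * t₃ * t₁
    t-product = solve 3 (λ t₁ t₂ t₃ → t₁ :* t₂ :* t₃ := t₂ :* t₃ :* t₁) refl t₁ t₂ t₃
    s-product : s₁ * s₂ * s₃ ≈ s₂ * s₃ * s₁
    s-product = solve 3 (λ s₁ s₂ s₃ → s₁ :* s₂ :* s₃ := s₂ :* s₃ :* s₁) refl s₁ s₂ s₃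
    st-sum : s₁ * t₂ * t₃ + t₁ * s₂ * t₃ + t₁ * t₂ * s₃ ≈ s₂ * t₃ * t₁ + t₂ * s₃ * t₁ + t₂ * t₃ * s₁
    st-sum = solve 6 (λ s₁ t₁ s₂ t₂ s₃ t₃ →
               s₁ :* t₂ :* t₃ :+ t₁ :* s₂ :* t₃ :+ t₁ :* t₂ :* s₃
                 := s₂ :* t₃ :* t₁ :+ t₂ :* s₃ :* t₁ :+ t₂ :* t₃ :* s₁) refl s₁ t₁ s₂ t₂ s₃ t₃
    ss-sum : s₁ * s₂ * t₃ + s₁ * t₂ * s₃ + t₁ * s₂ * s₃ ≈ s₂ * s₃ * t₁ + s₂ * t₃ * s₁ + t₂ * s₃ * s₁
    ss-sum = solve 6 (λ s₁ t₁ s₂ t₂ s₃ t₃ →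
               s₁ :* s₂ :* t₃ :+ s₁ :* t₂ :* s₃ :+ t₁ :* s₂ :* s₃
                 := s₂ :* s₃ :* t₁ :+ s₂ :* t₃ :* s₁ :+ t₂ :* s₃ :* s₁) refl s₁ t₁ s₂ t₂ s₃ t₃

  first-on-line : ∀ P Q → P ≈V comb 1# P 0# Q
  first-on-line P Q = unit (vx P) (vx Q) , unit (vy P) (vy Q) , unit (vz P) (vz Q)
    where
    unit : ∀ u w → u ≈ 1# * u + 0# * w
    unit = solve 2 (λ u w → u := 1ᴾ :* u :+ 0ᴾ :* w) refl

  second-on-line : ∀ P Q → Q ≈V comb 0# P 1# Q
  second-on-line P Q = unit (vx P) (vx Q) , unit (vy P) (vy Q) , unit (vz P) (vz Q)
    where
    unit : ∀ u w → w ≈ 0# * u + 1# * w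
    unit = solve 2 (λ u w → w := 0ᴾ :* u :+ 1ᴾ :* w) refl

  -- The chord through two points P, Q of C: on the line s P + t Q, F restricts
  -- to s t (B s + C t) with B = ∇F(P)·Q and C = ∇F(Q)·P, so its third point
  -- is (s , t) with c s = C and c t = -B for any c ≠ 0.
  chord : ∀ {P Q R} → OnC P → OnC Q → Independent P Q →
          ∀ c s t → ¬ (c ≈ 0#) → c * s ≈ grad· Q P → c * t ≈ - grad· P Q →
          R ≈V comb s P t Q → Intersection P Q R
  chord {P} {Q} P∈C Q∈C ind c s t c≉0 cs≈C ct≈-B R≈ =
    P , Q , ind , 1# , 0# , 0# , 1# , s , t ,
    first-on-line P Q , second-on-line P Q , R≈ , c , c≉0 ,
    trans P∈C (solve 2 (λ c t → 0ᴾ := c :* (0ᴾ :* 1ᴾ :* t)) refl c t) ,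
    (begin
      grad· P Q       ≈⟨ solve 1 (λ B → B := :- (:- B)) refl _ ⟩
      - (- grad· P Q) ≈⟨ -‿cong ct≈-B ⟨
      - (c * t)       ≈⟨ solve 3 (λ c s t → :- (c :* t)
                             := c :* (:- (1ᴾ :* 1ᴾ :* t :+ 0ᴾ :* 0ᴾ :* t :+ 0ᴾ :* 1ᴾ :* s))) refl c s t ⟩
      c * (- (1# * 1# * t + 0# * 0# * t + 0# * 1# * s)) ∎) ,
    (begin
      grad· Q P  ≈⟨ cs≈C ⟨
      c * s      ≈⟨ solve 3 (λ c s t → c :* s := c :* (1ᴾ :* 0ᴾ :* t :+ 1ᴾ :* 1ᴾ :* s :+ 0ᴾ :* 0ᴾ :* s))
                      refl c s t ⟩
      c * (1# * 0# * t + 1# * 1# * s + 0# * 0# * s) ∎) ,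
    trans Q∈C (solve 2 (λ c s → 0ᴾ := c :* (:- (1ᴾ :* 0ᴾ :* s))) refl c s)

  O-on-C : OnC O
  O-on-C = solve 3 (λ a b K → Fᴾ a b K Oᴾ := 0ᴾ) refl a b K

  -- O is off the affine plane, so it spans a line with every affine point
  O-independent : ∀ x y → Independent O (aff x y)
  O-independent x y (first≈0 , _) =
    -‿nonzero 1≉0 (trans (solve 1 (λ y → :- 1ᴾ := :- 1ᴾ :* 1ᴾ :- 0ᴾ :* y) refl y) first≈0)

  affine-independent : ∀ {x₁ y₁ x₂ y₂} → ¬ (x₁ - x₂ ≈ 0#) → Independent (aff x₁ y₁) (aff x₂ y₂)
  affine-independent {x₁} {y₁} {x₂} {y₂} x₁-x₂≉0 (_ , second≈0 , _) = x₁-x₂≉0 (begin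
    x₁ - x₂                ≈⟨ solve 2 (λ x₁ x₂ → x₁ :- x₂ := :- (1ᴾ :* x₂ :- x₁ :* 1ᴾ)) refl x₁ x₂ ⟩
    - (1# * x₂ - x₁ * 1#)  ≈⟨ -‿cong second≈0 ⟩
    - 0#                   ≈⟨ -0#≈0# ⟩
    0#                     ∎)

  -- The tangent line to C at O is x + y = K z.  It passes through
  -- P₀ = [K : 0 : 1], and F restricted to it is c₀ t³ with c₀ = F(P₀).
  P₀ : V3 Carrier
  P₀ = aff K 0#

  c₀ : Carrier
  c₀ = F P₀

  c₀-factor : c₀ ≈ (a * K + b) * (K + a)
  c₀-factor = solve 3 (λ a b K → Fᴾ a b K (affᴾ K 0ᴾ) := (a :* K :+ b) :* (K :+ a)) refl a b K

  O-flex : ¬ (c₀ ≈ 0#) → Intersection O O O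
  O-flex c₀≉0 =
    O , P₀ , O-independent K 0# , 1# , 0# , 1# , 0# , 1# , 0# ,
    first-on-line O P₀ , first-on-line O P₀ , first-on-line O P₀ , - c₀ , -‿nonzero c₀≉0 ,
    solve 4 (λ a b K c → Fᴾ a b K Oᴾ := c :* (0ᴾ :* 0ᴾ :* 0ᴾ)) refl a b K (- c₀) ,
    solve 4 (λ a b K c → gradᴾ a b K Oᴾ (affᴾ K 0ᴾ)
                         := c :* (:- (1ᴾ :* 0ᴾ :* 0ᴾ :+ 0ᴾ :* 1ᴾ :* 0ᴾ :+ 0ᴾ :* 0ᴾ :* 1ᴾ))) refl a b K (- c₀) ,
    solve 4 (λ a b K c → gradᴾ a b K (affᴾ K 0ᴾ) Oᴾ
                         := c :* (1ᴾ :* 1ᴾ :* 0ᴾ :+ 1ᴾ :* 0ᴾ :* 1ᴾ :+ 0ᴾ :* 1ᴾ :* 1ᴾ)) refl a b K (- c₀) ,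
    solve 3 (λ a b K → Fᴾ a b K (affᴾ K 0ᴾ) := (:- Fᴾ a b K (affᴾ K 0ᴾ)) :* (:- (1ᴾ :* 1ᴾ :* 1ᴾ))) refl a b K

  F-affine : ∀ x y → F (aff x y) ≈ (x + y - K) * (x * y + a * (x + y + K) + a * a + b) + c₀
  F-affine x y = solve 5 (λ a b K x y →
      Fᴾ a b K (affᴾ x y)
        := (x :+ y :- K) :* (x :* y :+ a :* (x :+ y :+ K) :+ a :* a :+ b) :+ Fᴾ a b K (affᴾ K 0ᴾ))
    refl a b K x y

  off-tangent : ¬ (c₀ ≈ 0#) → ∀ {x y} → OnC (aff x y) → ¬ (x + y - K ≈ 0#)
  off-tangent c₀≉0 {x} {y} on-C on-tangent = c₀≉0 (begin
    c₀                ≈⟨ solve 2 (λ g c → c := 0ᴾ :* g :+ c) refl G c₀ ⟩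
    0# * G + c₀       ≈⟨ +-congʳ (*-congʳ on-tangent) ⟨
    (x + y - K) * G + c₀ ≈⟨ F-affine x y ⟨
    F (aff x y)       ≈⟨ on-C ⟩
    0#                ∎)
    where
    G : Carrier
    G = x * y + a * (x + y + K) + a * a + b

  -- The line through O and an affine point (x , y) of C is x + y = const;
  -- it meets C a third time at (y , x).
  line-through-O : ¬ (c₀ ≈ 0#) → ∀ {x y} → OnC (aff x y) → Intersection O (aff x y) (aff y x)
  line-through-O c₀≉0 {x} {y} on-C =
    chord O-on-C on-C (O-independent x y) (x + y - K) (y - x) 1# (off-tangent c₀≉0 on-C)
      (solve 5 (λ a b K x y → (x :+ y :- K) :* (y :- x) := gradᴾ a b K (affᴾ x y) Oᴾ)
         refl a b K x y)
      (solve 5 (λ a b K x y → (x :+ y :- K) :* 1ᴾ := :- gradᴾ a b K Oᴾ (affᴾ x y))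
         refl a b K x y)
      (solve 2 (λ x y → y := (y :- x) :* 1ᴾ :+ 1ᴾ :* x) refl x y ,
       solve 2 (λ x y → x := (y :- x) :* (:- 1ᴾ) :+ 1ᴾ :* y) refl x y ,
       solve 2 (λ x y → 1ᴾ := (y :- x) :* 0ᴾ :+ 1ᴾ :* 1ᴾ) refl x y)

  -- If c₀ = 0, C contains its tangent line at O, and the points where this
  -- line meets the conic G are singular; they are [t : K - t : 1] with
  -- t² - K t - q₀ = 0.
  q₀ : Carrier
  q₀ = a * K + a * K + a * a + b

  singular-on-tangent : ∀ t → (a * K + b) * (K + a) ≈ 0# → IsQuadraticRoot k K q₀ t →
                        Singular ⟨ t , K - t , 1# ⟩
  singular-on-tangent t c₀≈0 t-root =
    (λ (_ , _ , 1≈0) → 1≉0 1≈0) ,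
    drop-vanishing (solve 4 (λ a b K t → Fᴾ a b K (Pᴾ K t)
      := 0ᴾ :+ 1ᴾ :* c₀ᴾ a b K :+ 0ᴾ :* rootᴾ a b K t) refl a b K t) c₀≈0 t-root ,
    drop-vanishing (solve 4 (λ a b K t → Fxᴾ a b K (Pᴾ K t)
      := 0ᴾ :+ 0ᴾ :* c₀ᴾ a b K :+ (:- 1ᴾ) :* rootᴾ a b K t) refl a b K t) c₀≈0 t-root ,
    drop-vanishing (solve 4 (λ a b K t → Fyᴾ a b K (Pᴾ K t)
      := 0ᴾ :+ 0ᴾ :* c₀ᴾ a b K :+ (:- 1ᴾ) :* rootᴾ a b K t) refl a b K t) c₀≈0 t-root ,
    drop-vanishing (solve 4 (λ a b K t → Fzᴾ a b K (Pᴾ K t)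
      := 0ᴾ :+ 3ᴾ :* c₀ᴾ a b K :+ K :* rootᴾ a b K t) refl a b K t) c₀≈0 t-root
    where
    module _ {n : ℕ} where
      Pᴾ : Polynomial n → Polynomial n → V3 (Polynomial n)
      Pᴾ K t = ⟨ t , K :- t , 1ᴾ ⟩
      c₀ᴾ : Polynomial n → Polynomial n → Polynomial n → Polynomial n
      c₀ᴾ a b K = (a :* K :+ b) :* (K :+ a)
      rootᴾ : Polynomial n → Polynomial n → Polynomial n → Polynomial n → Polynomial n
      rootᴾ a b K t = t :* t :- K :* t :- (a :* K :+ a :* K :+ a :* a :+ b)

module Transport {c ℓ : Level} (k L : Field c ℓ) (φ : Field.Carrier k → Field.Carrier L)
  (φ-hom : RingMorphisms.IsRingHomomorphism (Field.rawRing k) (Field.rawRing L) φ)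
  (a b K : Field.Carrier k) where
  private module k = Field k
  open Field L
  open RingMorphisms.IsRingHomomorphism φ-hom
  open import Relation.Binary.Reasoning.Setoid setoid

  c₀-factor-image : (a k.* K k.+ b) k.* (K k.+ a) k.≈ k.0# →
                    (φ a * φ K + φ b) * (φ K + φ a) ≈ 0#
  c₀-factor-image c₀≈0 = begin
    (φ a * φ K + φ b) * (φ K + φ a)    ≈⟨ *-cong (trans (+-homo _ b) (+-congʳ (*-homo a K)))
                                                  (+-homo K a) ⟨
    φ (a k.* K k.+ b) * φ (K k.+ a)    ≈⟨ *-homo _ _ ⟨
    φ ((a k.* K k.+ b) k.* (K k.+ a))  ≈⟨ ⟦⟧-cong c₀≈0 ⟩
    φ k.0#                             ≈⟨ 0#-homo ⟩
    0#                                 ∎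

  q₀-image : φ (a k.* K k.+ a k.* K k.+ a k.* a k.+ b)
             ≈ φ a * φ K + φ a * φ K + φ a * φ a + φ b
  q₀-image = begin
    φ (a k.* K k.+ a k.* K k.+ a k.* a k.+ b)         ≈⟨ +-homo _ b ⟩
    φ (a k.* K k.+ a k.* K k.+ a k.* a) + φ b         ≈⟨ +-congʳ (+-homo _ _) ⟩
    φ (a k.* K k.+ a k.* K) + φ (a k.* a) + φ b       ≈⟨ +-congʳ (+-cong (+-homo _ _) (*-homo a a)) ⟩
    φ (a k.* K) + φ (a k.* K) + φ a * φ a + φ b       ≈⟨ +-congʳ (+-congʳ (+-cong (*-homo a K) (*-homo a K))) ⟩
    φ a * φ K + φ a * φ K + φ a * φ a + φ b           ∎

-- Smoothness forces c₀ ≠ 0: otherwise a root of t² - K t - q₀, which exists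
-- in some extension field, gives a singular point of C over that field.
smooth⇒c₀≉0 : ∀ {c ℓ} (k : Field c ℓ) (a b K : Field.Carrier k) → Smooth k a b K →
              ¬ (Field._≈_ k (CurveFacts.c₀ k a b K) (Field.0# k))
smooth⇒c₀≉0 k a b K smooth c₀≈0 = root-in-extension k K q₀ λ extension →
  let open RootExtension extension
      open Transport k L embed embed-hom a b K
  in smooth L embed embed-hom _
       (CurveFacts.singular-on-tangent L (embed a) (embed b) (embed K) root
         (c₀-factor-image (Field.trans k (Field.sym k c₀-factor) c₀≈0))
         (Field.trans L (Field.+-congˡ L (Field.-‿cong L (Field.sym L q₀-image))) root-eq))
  where open CurveFacts k a b K using (q₀; c₀-factor)

module GroupLaw {c ℓ : Level} (k : Field c ℓ) (a b K : Field.Carrier k)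
  (c₀≉0 : ¬ (Field._≈_ k (CurveFacts.c₀ k a b K) (Field.0# k))) where
  open FieldFacts k
  open Curve k a b K
  open CurveFacts k a b K

  -- the chord through (x , y) and (y , x) meets C again at O, and the
  -- tangent at O meets C only at O; so -(x , y) = (y , x)
  negation : ∀ x y → OnC (aff x y) → Sum (aff x y) (aff y x) O
  negation x y on-C = O , O-on-C , Intersection-rotate (line-through-O c₀≉0 on-C) , O-flex c₀≉0

  module Addition (x₁ y₁ x₂ y₂ : Carrier) (on₁ : OnC (aff x₁ y₁)) (on₂ : OnC (aff x₂ y₂))
    (dx : ¬ (y₁ * y₂ * (x₁ - x₂) * (x₁ - x₂ + y₁ - y₂) ≈ 0#))
    (dy : ¬ (x₁ * x₂ * (y₁ - y₂) * (x₁ - x₂ + y₁ - y₂) ≈ 0#)) where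

    P₁ P₂ : V3 Carrier
    P₁ = aff x₁ y₁
    P₂ = aff x₂ y₂

    B C Δ : Carrier
    B = grad· P₁ P₂
    C = grad· P₂ P₁
    Δ = C - B

    S Dx Dy Nx Ny x₃ y₃ : Carrier
    S  = x₁ - x₂ + y₁ - y₂
    Dx = y₁ * y₂ * (x₁ - x₂) * S
    Dy = x₁ * x₂ * (y₁ - y₂) * S
    Nx = (a * y₁ - a * y₂ - x₁ * y₂ + x₂ * y₁) * (a * x₁ * y₂ - a * x₂ * y₁ - b * y₁ + b * y₂)
    Ny = (a * x₁ - a * x₂ + x₁ * y₂ - x₂ * y₁) * (a * x₂ * y₁ - a * x₁ * y₂ - b * x₁ + b * x₂)
    x₃ = div Nx Dx dx
    y₃ = div Ny Dy dy

    Δ-factor : Δ ≈ (x₁ - x₂) * (y₁ - y₂) * S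
    Δ-factor = drop-vanishing (solve 7 (λ a b K x₁ y₁ x₂ y₂ →
        gradᴾ a b K (affᴾ x₂ y₂) (affᴾ x₁ y₁) :- gradᴾ a b K (affᴾ x₁ y₁) (affᴾ x₂ y₂)
          := (x₁ :- x₂) :* (y₁ :- y₂) :* (x₁ :- x₂ :+ y₁ :- y₂)
             :+ 1ᴾ :* Fᴾ a b K (affᴾ x₂ y₂) :+ (:- 1ᴾ) :* Fᴾ a b K (affᴾ x₁ y₁))
      refl a b K x₁ y₁ x₂ y₂) on₂ on₁

    -- so the chord is not tangent: Dx Dy is a multiple of Δ
    Δ≉0 : ¬ (Δ ≈ 0#)
    Δ≉0 Δ≈0 = *-nonzero dx dy (begin
      Dx * Dy                                  ≈⟨ solve 5 (λ x₁ y₁ x₂ y₂ S →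
                                                    y₁ :* y₂ :* (x₁ :- x₂) :* S :* (x₁ :* x₂ :* (y₁ :- y₂) :* S)
                                                      := (y₁ :* y₂ :* x₁ :* x₂ :* S) :* ((x₁ :- x₂) :* (y₁ :- y₂) :* S))
                                                   refl x₁ y₁ x₂ y₂ S ⟩
      y₁ * y₂ * x₁ * x₂ * S * ((x₁ - x₂) * (y₁ - y₂) * S) ≈⟨ *-congˡ (trans (sym Δ-factor) Δ≈0) ⟩
      y₁ * y₂ * x₁ * x₂ * S * 0#               ≈⟨ zeroʳ _ ⟩
      0#                                       ∎)

    -- the third point of the chord is s₃ P₁ + t₃ P₂ with Δ s₃ = C and Δ t₃ = -B
    Δ⁻¹ s₃ t₃ : Carrier
    Δ⁻¹ = inv Δ Δ≉0
    s₃  = C * Δ⁻¹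
    t₃  = (- B) * Δ⁻¹

    -- The key identities: modulo the equations of P₁ and P₂, the coordinates
    -- (C y₁ - B y₂)/Δ and (C x₁ - B x₂)/Δ of the third point are Nx/Dx and Ny/Dy.
    x-identity : (C * y₁ - B * y₂) * Dx ≈ Nx * Δ
                   + (Nx - (x₁ - x₂) * S * (y₂ * y₂ * y₂)) * F P₁
                   + ((x₁ - x₂) * S * (y₁ * y₁ * y₁) - Nx) * F P₂
    x-identity = solve 7 (λ a b K x₁ y₁ x₂ y₂ →
      let P₁ = affᴾ x₁ y₁ ; P₂ = affᴾ x₂ y₂
          S  = x₁ :- x₂ :+ y₁ :- y₂
          Nx = (a :* y₁ :- a :* y₂ :- x₁ :* y₂ :+ x₂ :* y₁) :* (a :* x₁ :* y₂ :- a :* x₂ :* y₁ :- b :* y₁ :+ b :* y₂)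
      in (gradᴾ a b K P₂ P₁ :* y₁ :- gradᴾ a b K P₁ P₂ :* y₂) :* (y₁ :* y₂ :* (x₁ :- x₂) :* S)
           := Nx :* (gradᴾ a b K P₂ P₁ :- gradᴾ a b K P₁ P₂)
              :+ (Nx :- (x₁ :- x₂) :* S :* (y₂ :* y₂ :* y₂)) :* Fᴾ a b K P₁
              :+ ((x₁ :- x₂) :* S :* (y₁ :* y₁ :* y₁) :- Nx) :* Fᴾ a b K P₂)
      refl a b K x₁ y₁ x₂ y₂

    y-identity : (C * x₁ - B * x₂) * Dy ≈ Ny * Δ
                   + (Ny - (y₁ - y₂) * S * (x₂ * x₂ * x₂)) * F P₁
                   + ((y₁ - y₂) * S * (x₁ * x₁ * x₁) - Ny) * F P₂
    y-identity = solve 7 (λ a b K x₁ y₁ x₂ y₂ →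
      let P₁ = affᴾ x₁ y₁ ; P₂ = affᴾ x₂ y₂
          S  = x₁ :- x₂ :+ y₁ :- y₂
          Ny = (a :* x₁ :- a :* x₂ :+ x₁ :* y₂ :- x₂ :* y₁) :* (a :* x₂ :* y₁ :- a :* x₁ :* y₂ :- b :* x₁ :+ b :* x₂)
      in (gradᴾ a b K P₂ P₁ :* x₁ :- gradᴾ a b K P₁ P₂ :* x₂) :* (x₁ :* x₂ :* (y₁ :- y₂) :* S)
           := Ny :* (gradᴾ a b K P₂ P₁ :- gradᴾ a b K P₁ P₂)
              :+ (Ny :- (y₁ :- y₂) :* S :* (x₂ :* x₂ :* x₂)) :* Fᴾ a b K P₁
              :+ ((y₁ :- y₂) :* S :* (x₁ :* x₁ :* x₁) :- Ny) :* Fᴾ a b K P₂)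
      refl a b K x₁ y₁ x₂ y₂

    line-coordinate : ∀ u₁ u₂ → s₃ * u₁ + t₃ * u₂ ≈ (C * u₁ - B * u₂) * Δ⁻¹
    line-coordinate = solve 5 (λ B C i u₁ u₂ → C :* i :* u₁ :+ (:- B) :* i :* u₂ := (C :* u₁ :- B :* u₂) :* i)
                        refl B C Δ⁻¹

    third-point : aff y₃ x₃ ≈V comb s₃ P₁ t₃ P₂
    third-point =
      sym (trans (line-coordinate x₁ x₂) (div-cross _ Dy Ny Δ dy Δ≉0 (drop-vanishing y-identity on₁ on₂))) ,
      sym (trans (line-coordinate y₁ y₂) (div-cross _ Dx Nx Δ dx Δ≉0 (drop-vanishing x-identity on₁ on₂))) ,
      sym (trans (line-coordinate 1# 1#)
                 (trans (*-congʳ (solve 2 (λ B C → C :* 1ᴾ :- B :* 1ᴾ := C :- B) refl B C))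
                        (inv-inverse Δ Δ≉0)))

    chord₁₂ : Intersection P₁ P₂ (aff y₃ x₃)
    chord₁₂ = chord on₁ on₂ (affine-independent (nonzero-factorʳ (nonzero-factorˡ dx)))
                Δ s₃ t₃ Δ≉0 (*-div-cancel Δ Δ≉0 C) (*-div-cancel Δ Δ≉0 (- B)) third-point

    sum : Sum P₁ P₂ (aff x₃ y₃)
    sum = aff y₃ x₃ , third-on-C , chord₁₂ , line-through-O c₀≉0 third-on-C
      where
      third-on-C : OnC (aff y₃ x₃)
      third-on-C = intersection-on-C chord₁₂

mainTheorem2 :
    ∀ {c ℓ} (k : Field c ℓ) (a b K : Field.Carrier k) → Smooth k a b K →
    let open Field k
        open Curve k a b K
    in
    -- negation: -(x,y) = (y,x)
    (∀ (x y : Carrier) → OnC (aff x y) → Sum (aff x y) (aff y x) O)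
    ×
    -- addition formula
    (∀ (x₁ y₁ x₂ y₂ : Carrier) → OnC (aff x₁ y₁) → OnC (aff x₂ y₂) →
      (dx : ¬ (y₁ * y₂ * (x₁ - x₂) * (x₁ - x₂ + y₁ - y₂) ≈ 0#)) →
      (dy : ¬ (x₁ * x₂ * (y₁ - y₂) * (x₁ - x₂ + y₁ - y₂) ≈ 0#)) →
      Sum (aff x₁ y₁) (aff x₂ y₂)
        (aff (div ((a * y₁ - a * y₂ - x₁ * y₂ + x₂ * y₁)
                   * (a * x₁ * y₂ - a * x₂ * y₁ - b * y₁ + b * y₂))
                  (y₁ * y₂ * (x₁ - x₂) * (x₁ - x₂ + y₁ - y₂)) dx)
             (div ((a * x₁ - a * x₂ + x₁ * y₂ - x₂ * y₁)
                   * (a * x₂ * y₁ - a * x₁ * y₂ - b * x₁ + b * x₂))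
                  (x₁ * x₂ * (y₁ - y₂) * (x₁ - x₂ + y₁ - y₂)) dy)))
mainTheorem2 k a b K smooth =
  negation , λ x₁ y₁ x₂ y₂ on₁ on₂ dx dy → Addition.sum x₁ y₁ x₂ y₂ on₁ on₂ dx dy
  where open GroupLaw k a b K (smooth⇒c₀≉0 k a b K smooth)
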